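{- Let $G$ be a finite simple graph on $n$ vertices. Then $\frac{M_0(\mathcal B_L(G))-n}{2}\le Z_L(G)$ and $\gamma_{\rm gr}^L(G)\le \frac12\operatorname{mr}_0(\mathcal B_L(G))$.
   Context: For $G$ on vertex set $\{1,\ldots,n\}$, $\mathcal B_L(G)$ is the bipartite graph with vertex set $\{x_1,\ldots,x_n\}\cup\{y_1,\ldots,y_n\}\cup\{z_1,\ldots,z_n\}$ and edge set $\{\{x_i,y_j\},\{x_i,z_j\}:\{i,j\}\in E(G)\}\cup\{\{x_i,y_i\}:i\in V(G)\}$. For a graph $H$ on $m$ vertices, $\mathcal S_0(H)$ is the set of real symmetric $m\times m$ matrices with zero diagonal and off-diagonal $(i,j)$-entry nonzero iff $\{i,j\}\in E(H)$; $\operatorname{mr}_0(H)$ is the minimum rank over $\mathcal S_0(H)$ and $M_0(H)=m-\operatorname{mr}_0(H)$. An $L$-sequence of $G$ is a sequence $(v_1,\ldots,v_k)$ of distinct vertices with $N[v_i]\setminus\bigcup_{j<i}N(v_j)\ne\emptyset$ for all $i$ ($N$, $N[\cdot]$ open/closed neighborhoods); $\gamma_{\rm gr}^L(G)$ is the maximum length of one. $Z_L(G)$ is the minimum size of an initial blue set (others white) such that repeatedly applying the following makes all vertices blue: for $x\ne y$, if $y\in N(x)$ and all of $N(x)$ is blue except $y$, then $y$ turns blue; for $x=y$, if $x$ is white and all of $N(x)$ is blue, then $x$ turns blue. -}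

module Defs where

open import Level using (0ℓ)
open import Data.Nat using (ℕ; zero; suc; _≤_)
import Data.Nat as ℕ
open import Data.Bool using (Bool; true; false; _∨_)
open import Data.Fin using (Fin; zero; suc; splitAt; _<_)
import Data.Fin as Fin
open import Data.Fin.Subset using (Subset; _∈_; ∣_∣)
open import Data.Sum using (_⊎_; inj₁; inj₂)
open import Data.Product using (Σ; ∃; ∃-syntax; _×_; _,_)
open import Relation.Nullary using (¬_; does)
open import Relation.Binary.PropositionalEquality using (_≡_; _≢_)
open import Relation.Binary.Structures using (IsTotalOrder)
open import Function.Definitions using (Injective)
open import Algebra.Bundles using (CommutativeRing)
import Data.Fin.Properties as FinP

-- The real numbers, axiomatised as a Dedekind-complete ordered field
-- (unique up to isomorphism, so quantifying over all such structures
-- is the same as speaking about ℝ).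

record RealField : Set₁ where
  field
    commRing : CommutativeRing 0ℓ 0ℓ
  open CommutativeRing commRing public
  field
    _≤ᴿ_       : Carrier → Carrier → Set
    1≉0        : ¬ (1# ≈ 0#)
    inverse    : ∀ x → ¬ (x ≈ 0#) → ∃[ y ] (x * y ≈ 1#)
    isTotalOrder : IsTotalOrder _≈_ _≤ᴿ_
    +-mono     : ∀ x y z → x ≤ᴿ y → (x + z) ≤ᴿ (y + z)
    *-nonneg   : ∀ x y → 0# ≤ᴿ x → 0# ≤ᴿ y → 0# ≤ᴿ (x * y)
    complete   : (P : Carrier → Set) → ∃ P →
                 (∃[ b ] (∀ x → P x → x ≤ᴿ b)) →
                 ∃[ s ] ((∀ x → P x → x ≤ᴿ s) ×
                         (∀ b → (∀ x → P x → x ≤ᴿ b) → s ≤ᴿ b))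

Minimum : (ℕ → Set) → ℕ → Set
Minimum P k = P k × (∀ m → P m → k ≤ m)

Maximum : (ℕ → Set) → ℕ → Set
Maximum P k = P k × (∀ m → P m → m ≤ k)

record Graph (n : ℕ) : Set where
  field
    adj     : Fin n → Fin n → Bool
    adj-sym : ∀ i j → adj i j ≡ adj j i
    irrefl  : ∀ i → adj i i ≡ false

open Graph public

Adj : ∀ {n} → Graph n → Fin n → Fin n → Set
Adj G i j = adj G i j ≡ true

-- The bipartite graph B_L(G) on Fin (n ℕ.+ (n ℕ.+ n)):
-- the first block is x_1..x_n, the second y_1..y_n, the third z_1..z_n.

data Part (n : ℕ) : Set where
  X Y Z : Fin n → Part n

part : ∀ {n} → Fin (n ℕ.+ (n ℕ.+ n)) → Part n
part {n} v with splitAt n v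
... | inj₁ i = X i
... | inj₂ w with splitAt n w
...   | inj₁ j = Y j
...   | inj₂ k = Z k

blAdj : ∀ {n} → Graph n → Part n → Part n → Bool
blAdj G (X i) (Y j) = adj G i j ∨ does (i FinP.≟ j)
blAdj G (Y j) (X i) = adj G i j ∨ does (i FinP.≟ j)
blAdj G (X i) (Z j) = adj G i j
blAdj G (Z j) (X i) = adj G i j
blAdj G _ _ = false

blAdj-sym : ∀ {n} (G : Graph n) a b → blAdj G a b ≡ blAdj G b a
blAdj-sym G (X i) (X j) = _≡_.refl
blAdj-sym G (X i) (Y j) = _≡_.refl
blAdj-sym G (X i) (Z j) = _≡_.refl
blAdj-sym G (Y i) (X j) = _≡_.refl
blAdj-sym G (Y i) (Y j) = _≡_.refl
blAdj-sym G (Y i) (Z j) = _≡_.refl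
blAdj-sym G (Z i) (X j) = _≡_.refl
blAdj-sym G (Z i) (Y j) = _≡_.refl
blAdj-sym G (Z i) (Z j) = _≡_.refl

blAdj-irrefl : ∀ {n} (G : Graph n) a → blAdj G a a ≡ false
blAdj-irrefl G (X i) = _≡_.refl
blAdj-irrefl G (Y i) = _≡_.refl
blAdj-irrefl G (Z i) = _≡_.refl

BL : ∀ {n} → Graph n → Graph (n ℕ.+ (n ℕ.+ n))
BL G = record
  { adj     = λ u v → blAdj G (part u) (part v)
  ; adj-sym = λ u v → blAdj-sym G (part u) (part v)
  ; irrefl  = λ u → blAdj-irrefl G (part u)
  }

module _ (R : RealField) where
  open RealField R using (Carrier; _≈_; _+_; _*_; 0#)

  Matrix : ℕ → Set
  Matrix m = Fin m → Fin m → Carrier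

  sumFin : ∀ {r} → (Fin r → Carrier) → Carrier
  sumFin {ℕ.zero}  f = 0#
  sumFin {ℕ.suc r} f = f Fin.zero + sumFin (λ k → f (Fin.suc k))

  IndepColumns : ∀ {m r} → Matrix m → (Fin r → Fin m) → Set
  IndepColumns {m} {r} A f =
    Injective _≡_ _≡_ f ×
    (∀ (c : Fin r → Carrier) →
       (∀ i → sumFin (λ k → c k * A i (f k)) ≈ 0#) →
       ∀ k → c k ≈ 0#)

  HasRank : ∀ {m} → Matrix m → ℕ → Set
  HasRank {m} A = Maximum (λ r → ∃[ f ] IndepColumns {m} {r} A f)

  InS0 : ∀ {m} → Graph m → Matrix m → Set
  InS0 H A =
    (∀ i j → A i j ≈ A j i) ×
    (∀ i → A i i ≈ 0#) ×
    (∀ i j → i ≢ j → (¬ (A i j ≈ 0#) → Adj H i j) × (Adj H i j → ¬ (A i j ≈ 0#)))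

  IsMr0 : ∀ {m} → Graph m → ℕ → Set
  IsMr0 H = Minimum (λ k → ∃[ A ] (InS0 H A × HasRank A k))

data Blue {n} (G : Graph n) (S : Subset n) : Fin n → Set where
  initial : ∀ {v} → v ∈ S → Blue G S v
  force   : ∀ {x y} → x ≢ y → Adj G x y →
            (∀ w → Adj G x w → w ≢ y → Blue G S w) → Blue G S y
  self    : ∀ {x} → (∀ w → Adj G x w → Blue G S w) → Blue G S x

IsLForcingSet : ∀ {n} → Graph n → Subset n → Set
IsLForcingSet G S = ∀ v → Blue G S v

IsZL : ∀ {n} → Graph n → ℕ → Set
IsZL {n} G = Minimum (λ k → ∃[ S ] (IsLForcingSet G S × ∣ S ∣ ≡ k))

IsLSequence : ∀ {n k} → Graph n → (Fin k → Fin n) → Set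
IsLSequence G f =
  Injective _≡_ _≡_ f ×
  (∀ i → ∃[ w ] ((w ≡ f i ⊎ Adj G (f i) w) × (∀ j → j < i → ¬ Adj G (f j) w)))

IsGammaGrL : ∀ {n} → Graph n → ℕ → Set
IsGammaGrL {n} G = Maximum (λ k → ∃[ f ] IsLSequence {n} {k} G f)

module Submission where

-- Both inequalities bound the rank k = mr₀(B_L(G)) of some A ∈ S₀(B_L(G)) from
-- below.  The common source is a *pivot family* of size r: distinct vertices
-- vᵢ of G with witnesses wᵢ ∈ N[vᵢ] and ranks such that vᵢ ~ wⱼ (i ≠ j) forces
-- rank vᵢ < rank vⱼ.  Its columns x_{vᵢ} together with the pivot columns
-- y_{vᵢ} (if wᵢ = vᵢ) or z_{wᵢ} (if vᵢ ~ wᵢ) are 2r independent columns of A: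
-- B_L(G) is bipartite with parts {x} and {y, z}, so they span a block
-- anti-diagonal submatrix with triangular blocks (triangular-independent,
-- paired-independent, pivot-family-independent).  An L-sequence of length g is
-- a pivot family ranked backwards (2g ≤ k); the vertices outside a forcing set
-- S form one ranked by the round in which they turn blue, with the forcing
-- vertex as witness (2(n - |S|) ≤ k, i.e. M₀(B_L(G)) - n ≤ 2 Z_L(G)).
-- S₀ only says that off-edge entries are not nonzero, so the zero pattern of A
-- holds up to double negation, which the decidable conclusions absorb.

open import Defs
open import Data.Nat using (ℕ; _+_; _*_; _∸_; _≤_)
open import Data.Product using (_×_)

open import Data.Nat using (zero; suc; z≤n; s≤s; _<_; _⊔_; _≤?_; _≤′_; ≤′-refl; ≤′-step)
open import Data.Nat.Properties
  using (≤-trans; <⇒≤; <-asym; <-irrefl; m≤m⊔n; m≤n⊔m; ≤⇒≤′; ∸-monoʳ-<;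
         ≮⇒≥; ≤∧≢⇒<; m∸n+n≡m; m≤n+o⇒m∸n≤o; +-monoˡ-≤)
  renaming (_<?_ to _<ℕ?_)
import Data.Nat.Properties as ℕ
open import Data.Nat.Induction using (<-wellFounded)
open import Data.Nat.Solver using (module +-*-Solver)
open import Data.Bool using (true; false; _∨_)
open import Data.Bool.Properties using (∨-identityʳ; ∨-zeroʳ) renaming (_≟_ to _≟ᵇ_)
open import Data.Fin using (Fin; splitAt; join; _↑ˡ_; _↑ʳ_; toℕ)
import Data.Fin as Fin
open import Data.Fin.Properties
  using (_≟_; any?; all?; suc-injective; join-splitAt; splitAt-↑ˡ; splitAt-↑ʳ;
         toℕ<n; toℕ-injective)
open import Data.Fin.Subset using (Subset; _∈_; _∉_; ∣_∣; ∁; inside; outside)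
open import Data.Fin.Subset.Properties using (_∈?_; x∈∁p⇒x∉p; ∣∁p∣≡n∸∣p∣; ∣p∣≤n)
open import Data.Vec using (_∷_; []; here; there)
open import Data.Sum using (_⊎_; inj₁; inj₂; [_,_])
open import Data.Product using (Σ-syntax; ∃; ∃-syntax; _,_; proj₁; proj₂)
open import Data.Empty using (⊥-elim)
open import Function using (_∘_)
open import Function.Definitions using (Injective)
import Relation.Binary.Construct.On as On
import Induction.WellFounded as WF
open import Relation.Nullary using (¬_; Dec; yes; no; ¬?)
open import Relation.Nullary.Decidable
  using (decidable-stable; dec-true; _⊎-dec_; _×-dec_; _→-dec_)
open import Relation.Nullary.Negation using (¬¬-map)
open import Relation.Unary using (Decidable)
open import Relation.Binary.PropositionalEquality
  using (_≡_; _≢_; refl; sym; trans; cong; cong₂; subst)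

bounded : ∀ {m} (f : Fin m → ℕ) → ∃[ D ] (∀ i → f i ≤ D)
bounded {zero} f = 0 , λ ()
bounded {suc m} f with bounded (f ∘ Fin.suc)
... | D , f≤D = f Fin.zero ⊔ D , λ where
  Fin.zero    → m≤m⊔n (f Fin.zero) D
  (Fin.suc i) → ≤-trans (f≤D i) (m≤n⊔m (f Fin.zero) D)

minimise : (P : ℕ → Set) → Decidable P → ∀ d → P d → ∃ (Minimum P)
minimise P P? zero    p = 0 , p , λ _ _ → z≤n
minimise P P? (suc d) p with P? 0
... | yes p₀ = 0 , p₀ , λ _ _ → z≤n
... | no ¬p₀ with minimise (P ∘ suc) (P? ∘ suc) d p
...   | d′ , p′ , least = suc d′ , p′ , λ where
  zero    p₀ → ⊥-elim (¬p₀ p₀)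
  (suc e) pₑ → s≤s (least e pₑ)

enumerate : ∀ {n} (p : Subset n) →
            Σ[ f ∈ (Fin ∣ p ∣ → Fin n) ] (Injective _≡_ _≡_ f × (∀ i → f i ∈ p))
enumerate [] = (λ ()) , (λ { {()} }) , λ ()
enumerate (outside ∷ p) with enumerate p
... | f , f-inj , f∈p = Fin.suc ∘ f , f-inj ∘ suc-injective , there ∘ f∈p
enumerate (inside ∷ p) with enumerate p
... | f , f-inj , f∈p = g , g-inj , g∈p
  where
  g : Fin (suc ∣ p ∣) → Fin _
  g Fin.zero    = Fin.zero
  g (Fin.suc i) = Fin.suc (f i)
  g-inj : Injective _≡_ _≡_ g
  g-inj {Fin.zero}  {Fin.zero}  _  = refl
  g-inj {Fin.suc i} {Fin.suc j} eq = cong Fin.suc (f-inj (suc-injective eq))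
  g-inj {Fin.zero}  {Fin.suc _} ()
  g-inj {Fin.suc _} {Fin.zero}  ()
  g∈p : ∀ i → g i ∈ (inside ∷ p)
  g∈p Fin.zero    = here
  g∈p (Fin.suc i) = there (f∈p i)

¬¬-∀Fin : ∀ {m} {P : Fin m → Set} → (∀ i → ¬ ¬ P i) → ¬ ¬ (∀ i → P i)
¬¬-∀Fin {zero}      h ¬all = ¬all λ ()
¬¬-∀Fin {suc m} {P} h ¬all =
  h Fin.zero λ p₀ → ¬¬-∀Fin (h ∘ Fin.suc) λ ps →
    ¬all λ { Fin.zero → p₀ ; (Fin.suc i) → ps i }

splitAt-injective : ∀ r {s} {a b : Fin (r + s)} → splitAt r a ≡ splitAt r b → a ≡ b
splitAt-injective r {s} {a} {b} eq =
  trans (sym (join-splitAt r s a)) (trans (cong (join r s) eq) (join-splitAt r s b))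

module LinearAlgebra (R : RealField) where
  open RealField R
    renaming (_+_ to _+ᴿ_; _*_ to _*ᴿ_; refl to ≈-refl; sym to ≈-sym; trans to ≈-trans)
  open import Relation.Binary.Reasoning.Setoid setoid

  cancel-nonzero : ∀ c a → ¬ (a ≈ 0#) → c *ᴿ a ≈ 0# → c ≈ 0#
  cancel-nonzero c a a≉0 ca≈0 with inverse a a≉0
  ... | a⁻¹ , aa⁻¹≈1 = begin
    c                ≈⟨ ≈-sym (*-identityʳ c) ⟩
    c *ᴿ 1#          ≈⟨ *-congˡ (≈-sym aa⁻¹≈1) ⟩
    c *ᴿ (a *ᴿ a⁻¹)  ≈⟨ ≈-sym (*-assoc c a a⁻¹) ⟩
    (c *ᴿ a) *ᴿ a⁻¹  ≈⟨ *-congʳ ca≈0 ⟩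
    0# *ᴿ a⁻¹        ≈⟨ zeroˡ a⁻¹ ⟩
    0#               ∎

  sumFin-zero : ∀ {r} (t : Fin r → Carrier) → (∀ j → t j ≈ 0#) → sumFin R t ≈ 0#
  sumFin-zero {zero}  t t≈0 = ≈-refl
  sumFin-zero {suc r} t t≈0 =
    ≈-trans (+-cong (t≈0 Fin.zero) (sumFin-zero (t ∘ Fin.suc) (t≈0 ∘ Fin.suc)))
            (+-identityʳ 0#)

  sumFin-single : ∀ {r} (t : Fin r → Carrier) (i : Fin r) →
                  (∀ j → j ≢ i → t j ≈ 0#) → sumFin R t ≈ t i
  sumFin-single {suc r} t Fin.zero t≈0 =
    ≈-trans (+-congˡ (sumFin-zero (t ∘ Fin.suc) (λ j → t≈0 (Fin.suc j) λ ())))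
            (+-identityʳ (t Fin.zero))
  sumFin-single {suc r} t (Fin.suc i) t≈0 =
    ≈-trans (+-cong (t≈0 Fin.zero λ ())
                    (sumFin-single (t ∘ Fin.suc) i
                       (λ j j≢i → t≈0 (Fin.suc j) (j≢i ∘ suc-injective))))
            (+-identityˡ (t (Fin.suc i)))

  triangular-independent :
    ∀ {m r} (A : Matrix R m) (col row : Fin r → Fin m) (μ : Fin r → ℕ) →
    (∀ a → ¬ (A (row a) (col a) ≈ 0#)) →
    (∀ a b → a ≢ b → A (row a) (col b) ≈ 0# ⊎ μ b < μ a) →
    IndepColumns R A col
  triangular-independent {m} {r} A col row μ pivot order = col-injective , coefficients-zero
    where
    nonzero-below : ∀ a b → a ≢ b → ¬ (A (row a) (col b) ≈ 0#) → μ b < μ a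
    nonzero-below a b a≢b entry≉0 with order a b a≢b
    ... | inj₁ entry≈0 = ⊥-elim (entry≉0 entry≈0)
    ... | inj₂ μb<μa   = μb<μa

    col-injective : Injective _≡_ _≡_ col
    col-injective {a} {b} same with a ≟ b
    ... | yes a≡b = a≡b
    ... | no  a≢b = ⊥-elim (<-asym
      (nonzero-below a b a≢b (subst (λ c → ¬ (A (row a) c ≈ 0#)) same (pivot a)))
      (nonzero-below b a (a≢b ∘ sym) (subst (λ c → ¬ (A (row b) c ≈ 0#)) (sym same) (pivot b))))

    coefficients-zero : ∀ (c : Fin r → Carrier) →
                        (∀ i → sumFin R (λ k → c k *ᴿ A i (col k)) ≈ 0#) → ∀ k → c k ≈ 0#
    coefficients-zero c combination≈0 =
      WF.All.wfRec (On.wellFounded μ <-wellFounded) _ (λ a → c a ≈ 0#) step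
      where
      step : ∀ a → (∀ {b} → μ b < μ a → c b ≈ 0#) → c a ≈ 0#
      step a lower≈0 = cancel-nonzero (c a) (A (row a) (col a)) (pivot a)
        (≈-trans (≈-sym (sumFin-single _ a other-terms)) (combination≈0 (row a)))
        where
        other-terms : ∀ b → b ≢ a → c b *ᴿ A (row a) (col b) ≈ 0#
        other-terms b b≢a with order a b (b≢a ∘ sym)
        ... | inj₁ entry≈0 = ≈-trans (*-congˡ entry≈0) (zeroʳ (c b))
        ... | inj₂ μb<μa   = ≈-trans (*-congʳ (lower≈0 μb<μa)) (zeroˡ _)

  -- In a symmetric matrix, r pairs of indices (ρ i, κ i) with nonzero entries
  -- A (ρ i) (κ i), vanishing blocks on the ρ's and on the κ's, and the entry
  -- A (ρ i) (κ j) (i ≠ j) vanishing unless μ i < μ j, give 2r independent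
  -- columns: the κ's (pivot rows ρ, induction downwards in μ) and the ρ's
  -- (pivot rows κ, induction upwards in μ).
  paired-independent :
    ∀ {m r} (A : Matrix R m) → (∀ i j → A i j ≈ A j i) →
    (ρ κ : Fin r → Fin m) (μ : Fin r → ℕ) →
    (∀ i j → A (ρ i) (ρ j) ≈ 0#) → (∀ i j → A (κ i) (κ j) ≈ 0#) →
    (∀ i → ¬ (A (ρ i) (κ i) ≈ 0#)) →
    (∀ i j → i ≢ j → A (ρ i) (κ j) ≈ 0# ⊎ μ i < μ j) →
    ∃[ cols ] IndepColumns R {m} {r + r} A cols
  paired-independent {m} {r} A symmetric ρ κ μ ρρ≈0 κκ≈0 pivot order =
    col , triangular-independent A col row μ′ pivot′ order′
    where
    D : ℕ
    D = proj₁ (bounded μ)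

    μ≤D : ∀ i → μ i ≤ D
    μ≤D = proj₂ (bounded μ)

    col row : Fin (r + r) → Fin m
    col a = [ κ , ρ ] (splitAt r a)
    row a = [ ρ , κ ] (splitAt r a)

    μ′ : Fin (r + r) → ℕ
    μ′ a = [ (λ i → D ∸ μ i) , μ ] (splitAt r a)

    pivot′ : ∀ a → ¬ (A (row a) (col a) ≈ 0#)
    pivot′ a with splitAt r a
    ... | inj₁ i = pivot i
    ... | inj₂ i = pivot i ∘ ≈-trans (symmetric (ρ i) (κ i))

    same-half : ∀ {a b} {s t : Fin r ⊎ Fin r} →
                splitAt r a ≡ s → splitAt r b ≡ t → s ≡ t → splitAt r a ≡ splitAt r b
    same-half ea eb s≡t = trans ea (trans s≡t (sym eb))

    order′ : ∀ a b → a ≢ b → A (row a) (col b) ≈ 0# ⊎ μ′ b < μ′ a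
    order′ a b a≢b with splitAt r a in ea | splitAt r b in eb
    ... | inj₁ i | inj₁ j
      with order i j (a≢b ∘ splitAt-injective r ∘ same-half ea eb ∘ cong inj₁)
    ...   | inj₁ entry≈0 = inj₁ entry≈0
    ...   | inj₂ μi<μj   = inj₂ (∸-monoʳ-< μi<μj (μ≤D j))
    order′ a b a≢b | inj₂ i | inj₂ j
      with order j i (a≢b ∘ splitAt-injective r ∘ same-half ea eb ∘ cong inj₂ ∘ sym)
    ...   | inj₁ entry≈0 = inj₁ (≈-trans (symmetric (κ i) (ρ j)) entry≈0)
    ...   | inj₂ μj<μi   = inj₂ μj<μi
    order′ a b a≢b | inj₁ i | inj₂ j = inj₁ (ρρ≈0 i j)
    order′ a b a≢b | inj₂ i | inj₁ j = inj₁ (κκ≈0 i j)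

module ZeroPattern (R : RealField) {m} (H : Graph m) (A : Matrix R m) where
  open RealField R using (_≈_; 0#)

  OffEdgesZero : Set
  OffEdgesZero = ∀ u v → adj H u v ≡ false → A u v ≈ 0#

  s0-off-edges-zero : InS0 R H A → ¬ ¬ OffEdgesZero
  s0-off-edges-zero (_ , diagonal , off-diagonal) = ¬¬-∀Fin λ u → ¬¬-∀Fin λ v → entry u v
    where
    entry : ∀ u v → ¬ ¬ (adj H u v ≡ false → A u v ≈ 0#)
    entry u v ¬goal with u ≟ v
    ... | yes refl = ¬goal λ _ → diagonal u
    ... | no  u≢v  = ¬goal λ nonedge → ⊥-elim (true≢false (trans (sym edge) nonedge))
      where
      true≢false : true ≢ false
      true≢false ()
      edge : Adj H u v
      edge = proj₁ (off-diagonal u v u≢v) λ entry≈0 → ¬goal λ _ → entry≈0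

  s0-edge-nonzero : InS0 R H A → ∀ u v → Adj H u v → ¬ (A u v ≈ 0#)
  s0-edge-nonzero (_ , _ , off-diagonal) u v edge with u ≟ v
  ... | yes refl = ⊥-elim (false≢true (trans (sym (irrefl H u)) edge))
    where
    false≢true : false ≢ true
    false≢true ()
  ... | no u≢v = proj₂ (off-diagonal u v u≢v) edge

module Bipartite {n} (G : Graph n) where

  xI yI zI : Fin n → Fin (n + (n + n))
  xI i = i ↑ˡ (n + n)
  yI j = n ↑ʳ (j ↑ˡ n)
  zI k = n ↑ʳ (n ↑ʳ k)

  part-x : ∀ i → part (xI i) ≡ X i
  part-x i rewrite splitAt-↑ˡ n i (n + n) = refl

  part-y : ∀ i → part (yI i) ≡ Y i
  part-y i rewrite splitAt-↑ʳ n (n + n) (i ↑ˡ n) | splitAt-↑ˡ n i n = refl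

  part-z : ∀ i → part (zI i) ≡ Z i
  part-z i rewrite splitAt-↑ʳ n (n + n) (n ↑ʳ i) | splitAt-↑ʳ n n i = refl

  ClosedNbr : Fin n → Fin n → Set
  ClosedNbr v w = w ≡ v ⊎ Adj G v w

  pivot-part : ∀ v w → ClosedNbr v w → Part n
  pivot-part v w (inj₁ _) = Y v
  pivot-part v w (inj₂ _) = Z w

  pivot : ∀ v w → ClosedNbr v w → Fin (n + (n + n))
  pivot v w (inj₁ _) = yI v
  pivot v w (inj₂ _) = zI w

  part-pivot : ∀ v w e → part (pivot v w e) ≡ pivot-part v w e
  part-pivot v w (inj₁ _) = part-y v
  part-pivot v w (inj₂ _) = part-z w

  x-x-nonadjacent : ∀ a b → adj (BL G) (xI a) (xI b) ≡ false
  x-x-nonadjacent a b = cong₂ (blAdj G) (part-x a) (part-x b)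

  pivot-pivot-nonadjacent : ∀ v w e v′ w′ e′ →
                            adj (BL G) (pivot v w e) (pivot v′ w′ e′) ≡ false
  pivot-pivot-nonadjacent v w e v′ w′ e′ =
    trans (cong₂ (blAdj G) (part-pivot v w e) (part-pivot v′ w′ e′)) (yz-yz e e′)
    where
    yz-yz : ∀ e e′ → blAdj G (pivot-part v w e) (pivot-part v′ w′ e′) ≡ false
    yz-yz (inj₁ _) (inj₁ _) = refl
    yz-yz (inj₁ _) (inj₂ _) = refl
    yz-yz (inj₂ _) (inj₁ _) = refl
    yz-yz (inj₂ _) (inj₂ _) = refl

  pivot-adjacent : ∀ v w e → Adj (BL G) (xI v) (pivot v w e)
  pivot-adjacent v w (inj₁ _) =
    trans (cong₂ (blAdj G) (part-x v) (part-y v))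
          (trans (cong (adj G v v ∨_) (dec-true (v ≟ v) refl)) (∨-zeroʳ _))
  pivot-adjacent v w (inj₂ v~w) = trans (cong₂ (blAdj G) (part-x v) (part-z w)) v~w

  pivot-neighbour : ∀ u v w e → Adj (BL G) (xI u) (pivot v w e) → u ≡ v ⊎ Adj G u w
  pivot-neighbour u v .v (inj₁ refl) x~y
    with u ≟ v | trans (sym (cong₂ (blAdj G) (part-x u) (part-y v))) x~y
  ... | yes u≡v | _           = inj₁ u≡v
  ... | no _    | u~v∨false = inj₂ (trans (sym (∨-identityʳ _)) u~v∨false)
  pivot-neighbour u v w (inj₂ _) x~z =
    inj₂ (trans (sym (cong₂ (blAdj G) (part-x u) (part-z w))) x~z)

record PivotFamily {n} (G : Graph n) (r : ℕ) : Set where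
  field
    vertex           : Fin r → Fin n
    witness          : Fin r → Fin n
    closed           : ∀ i → Bipartite.ClosedNbr G (vertex i) (witness i)
    rank             : Fin r → ℕ
    vertex-injective : Injective _≡_ _≡_ vertex
    ordered          : ∀ i j → i ≢ j → Adj G (vertex i) (witness j) → rank i < rank j

pivot-family-independent :
  (R : RealField) {n : ℕ} (G : Graph n) (A : Matrix R (n + (n + n))) →
  InS0 R (BL G) A → ZeroPattern.OffEdgesZero R (BL G) A →
  ∀ {r} → PivotFamily G r → ∃[ cols ] IndepColumns R {_} {r + r} A cols
pivot-family-independent R G A A∈S0 zero-off F =
  paired-independent A (proj₁ A∈S0) ρ κ rank
    (λ i j → zero-off (ρ i) (ρ j) (x-x-nonadjacent (vertex i) (vertex j)))
    (λ i j → zero-off (κ i) (κ j) (pivot-pivot-nonadjacent _ _ (closed i) _ _ (closed j)))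
    (λ i → s0-edge-nonzero A∈S0 (ρ i) (κ i) (pivot-adjacent _ _ (closed i)))
    order
  where
  open RealField R using (_≈_; 0#)
  open LinearAlgebra R
  open ZeroPattern R (BL G) A
  open Bipartite G
  open PivotFamily F

  ρ κ : Fin _ → Fin _
  ρ i = xI (vertex i)
  κ i = pivot (vertex i) (witness i) (closed i)

  order : ∀ i j → i ≢ j → A (ρ i) (κ j) ≈ 0# ⊎ rank i < rank j
  order i j i≢j with adj (BL G) (ρ i) (κ j) in edge
  ... | false = inj₁ (zero-off _ _ edge)
  ... | true with pivot-neighbour _ _ _ (closed j) edge
  ...   | inj₁ same   = ⊥-elim (i≢j (vertex-injective same))
  ...   | inj₂ i~wⱼ = inj₂ (ordered i j i≢j i~wⱼ)

-- An L-sequence of length g, ranked in reverse order, is a pivot family: the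
-- witness of the j-th vertex is not adjacent to any earlier vertex.
lsequence-family : ∀ {n g} (G : Graph n) (f : Fin g → Fin n) →
                   IsLSequence G f → PivotFamily G g
lsequence-family {g = g} G f (f-inj , new) = record
  { vertex           = f
  ; witness          = λ i → proj₁ (new i)
  ; closed           = λ i → proj₁ (proj₂ (new i))
  ; rank             = λ i → g ∸ toℕ i
  ; vertex-injective = f-inj
  ; ordered          = ordered
  }
  where
  ordered : ∀ i j → i ≢ j → Adj G (f i) (proj₁ (new j)) → g ∸ toℕ i < g ∸ toℕ j
  ordered i j i≢j fᵢ~wⱼ = ∸-monoʳ-< j<i (<⇒≤ (toℕ<n i))
    where
    j<i : toℕ j < toℕ i
    j<i with toℕ i <ℕ? toℕ j
    ... | yes i<j = ⊥-elim (proj₂ (proj₂ (new j)) i i<j fᵢ~wⱼ)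
    ... | no  i≮j = ≤∧≢⇒< (≮⇒≥ i≮j) (i≢j ∘ sym ∘ toℕ-injective)

-- L-zero forcing organised in rounds, so that every vertex has a first
-- round in which it is blue.

module Forcing {n} (G : Graph n) (S : Subset n) where

  adj? : ∀ x w → Dec (Adj G x w)
  adj? x w = adj G x w ≟ᵇ true

  ForcedFrom : (Fin n → Set) → Fin n → Set
  ForcedFrom B v = (∃[ x ] (x ≢ v × Adj G x v × (∀ w → Adj G x w → w ≢ v → B w)))
                 ⊎ (∀ w → Adj G v w → B w)

  forcedFrom? : ∀ {B} → Decidable B → Decidable (ForcedFrom B)
  forcedFrom? B? v =
    any? (λ x → ¬? (x ≟ v) ×-dec adj? x v ×-dec
                all? (λ w → adj? x w →-dec ¬? (w ≟ v) →-dec B? w))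
    ⊎-dec all? (λ w → adj? v w →-dec B? w)

  BlueBy : ℕ → Fin n → Set
  BlueBy zero    v = v ∈ S
  BlueBy (suc d) v = BlueBy d v ⊎ ForcedFrom (BlueBy d) v

  blueBy? : ∀ d → Decidable (BlueBy d)
  blueBy? zero    v = v ∈? S
  blueBy? (suc d) v = blueBy? d v ⊎-dec forcedFrom? (blueBy? d) v

  blueBy-mono : ∀ {d e v} → d ≤ e → BlueBy d v → BlueBy e v
  blueBy-mono d≤e = mono (≤⇒≤′ d≤e)
    where
    mono : ∀ {d e v} → d ≤′ e → BlueBy d v → BlueBy e v
    mono ≤′-refl        blue = blue
    mono (≤′-step d≤′e) blue = inj₁ (mono d≤′e blue)

  common-round : (Q : Fin n → Set) → Decidable Q →
                 (∀ w → Q w → ∃[ d ] BlueBy d w) → ∃[ d ] (∀ w → Q w → BlueBy d w)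
  common-round Q Q? eventually = D , λ w q → blueBy-mono (D-bound w) (proj₂ (round w) q)
    where
    round : ∀ w → Σ[ d ∈ ℕ ] (Q w → BlueBy d w)
    round w with Q? w
    ... | yes q = proj₁ (eventually w q) , λ _ → proj₂ (eventually w q)
    ... | no ¬q = 0 , ⊥-elim ∘ ¬q
    D : ℕ
    D = proj₁ (bounded (proj₁ ∘ round))
    D-bound : ∀ w → proj₁ (round w) ≤ D
    D-bound = proj₂ (bounded (proj₁ ∘ round))

  blue-round : ∀ {v} → Blue G S v → ∃[ d ] BlueBy d v
  blue-round (initial v∈S) = 0 , v∈S
  blue-round (force {x} {y} x≢y x~y others) with
    common-round (λ w → Adj G x w × w ≢ y) (λ w → adj? x w ×-dec ¬? (w ≟ y))
                 (λ w (x~w , w≢y) → blue-round (others w x~w w≢y))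
  ... | d , blue = suc d , inj₂ (inj₁ (x , x≢y , x~y , λ w x~w w≢y → blue w (x~w , w≢y)))
  blue-round (self {x} nbrs) with
    common-round (Adj G x) (adj? x) (λ w x~w → blue-round (nbrs w x~w))
  ... | d , blue = suc d , inj₂ (inj₂ blue)

  module FirstRound (forcing : IsLForcingSet G S) where

    first-round : ∀ v → ∃ (Minimum (λ d → BlueBy d v))
    first-round v with blue-round (forcing v)
    ... | d , blue = minimise (λ d → BlueBy d v) (λ d → blueBy? d v) d blue

    first : Fin n → ℕ
    first v = proj₁ (first-round v)

    first-≤ : ∀ {e u} → BlueBy e u → first u ≤ e
    first-≤ {e} {u} blue = proj₂ (proj₂ (first-round u)) e blue

    entered : ∀ v → v ∉ S → ∃[ e ] (first v ≡ suc e × ForcedFrom (BlueBy e) v)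
    entered v v∉S with first-round v
    ... | zero  , v∈S           , _       = ⊥-elim (v∉S v∈S)
    ... | suc e , inj₁ earlier , minimal = ⊥-elim (<-irrefl refl (minimal e earlier))
    ... | suc e , inj₂ forced  , _       = e , refl , forced

    record ForcingPivot (v : Fin n) : Set where
      field
        witness : Fin n
        closed  : Bipartite.ClosedNbr G v witness
        earlier : ∀ u → u ≢ v → Adj G u witness → first u < first v

    forcing-pivot : ∀ v → v ∉ S → ForcingPivot v
    forcing-pivot v v∉S with entered v v∉S
    ... | e , first≡ , inj₁ (x , x≢v , x~v , others) = record
      { witness = x
      ; closed  = inj₂ (trans (adj-sym G v x) x~v)
      ; earlier = λ u u≢v u~x → subst (first u <_) (sym first≡)
                    (s≤s (first-≤ (others u (trans (adj-sym G x u) u~x) u≢v)))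
      }
    ... | e , first≡ , inj₂ nbrs = record
      { witness = v
      ; closed  = inj₁ refl
      ; earlier = λ u _ u~v → subst (first u <_) (sym first≡)
                    (s≤s (first-≤ (nbrs u (trans (adj-sym G v u) u~v))))
      }

forcing-family : ∀ {n} (G : Graph n) (S : Subset n) → IsLForcingSet G S →
                 PivotFamily G ∣ ∁ S ∣
forcing-family G S forcing = record
  { vertex           = vertex
  ; witness          = ForcingPivot.witness ∘ pivot-of
  ; closed           = ForcingPivot.closed ∘ pivot-of
  ; rank             = first ∘ vertex
  ; vertex-injective = vertex-injective
  ; ordered          = λ i j i≢j vᵢ~wⱼ →
      ForcingPivot.earlier (pivot-of j) (vertex i) (i≢j ∘ vertex-injective) vᵢ~wⱼ
  }
  where
  open Forcing G S
  open FirstRound forcing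

  vertex : Fin ∣ ∁ S ∣ → Fin _
  vertex = proj₁ (enumerate (∁ S))

  vertex-injective : Injective _≡_ _≡_ vertex
  vertex-injective = proj₁ (proj₂ (enumerate (∁ S)))

  pivot-of : ∀ i → ForcingPivot (vertex i)
  pivot-of i = forcing-pivot (vertex i) (x∈∁p⇒x∉p (proj₂ (proj₂ (enumerate (∁ S))) i))

excess-bound : ∀ n k z r → 2 * r ≤ k → r + z ≡ n → ((n + (n + n)) ∸ k) ∸ n ≤ 2 * z
excess-bound _ k z r 2r≤k refl =
  m≤n+o⇒m∸n≤o _ (r + z) (m≤n+o⇒m∸n≤o _ k
    (subst (_≤ k + ((r + z) + 2 * z)) (sym (regroup r z))
           (+-monoˡ-≤ ((r + z) + 2 * z) 2r≤k)))
  where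
  open +-*-Solver
  regroup : ∀ r z → (r + z) + ((r + z) + (r + z)) ≡ 2 * r + ((r + z) + 2 * z)
  regroup = solve 2 (λ r z → (r :+ z) :+ ((r :+ z) :+ (r :+ z))
                               := con 2 :* r :+ ((r :+ z) :+ con 2 :* z)) refl

corollary4p4 : (R : RealField) (n : ℕ) (G : Graph n) (k z g : ℕ) →
    IsMr0 R (BL G) k → IsZL G z → IsGammaGrL G g →
    ((n + (n + n)) ∸ k) ∸ n ≤ 2 * z × 2 * g ≤ k
corollary4p4 R n G k z g ((A , A∈S0 , A-rank) , _) ((S , forcing , ∣S∣≡z) , _) ((f , lseq) , _) =
  excess-bound n k z ∣ ∁ S ∣ (doubled (forcing-family G S forcing)) outside+inside ,
  doubled (lsequence-family G f lseq)
  where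
  -- A pivot family of size r forces 2r ≤ k; the zero pattern of A is only
  -- available under double negation, which the decidable conclusion absorbs.
  doubled : ∀ {r} → PivotFamily G r → 2 * r ≤ k
  doubled {r} F =
    subst (_≤ k) (cong (r +_) (sym (ℕ.+-identityʳ r))) (decidable-stable (r + r ≤? k)
      (¬¬-map (λ zero-off → proj₂ A-rank (r + r)
                              (pivot-family-independent R G A A∈S0 zero-off F))
              (ZeroPattern.s0-off-edges-zero R (BL G) A A∈S0)))

  outside+inside : ∣ ∁ S ∣ + z ≡ n
  outside+inside = trans (cong₂ _+_ (∣∁p∣≡n∸∣p∣ S) (sym ∣S∣≡z)) (m∸n+n≡m (∣p∣≤n S))
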